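{- At any point of the unbiased Waiter-Client triangle-factor game on $K_n$, let $C$ be a bad connected component of Client's graph. Then there exists at most one yet unclaimed edge with both endpoints in $C$ which, if offered by Waiter to Client, would be crucial.
   Context: The game: $n$ is divisible by $3$; initially all edges of $K_n$ are unclaimed. In each round Waiter offers two yet unclaimed edges; Client chooses one to be added to Client's graph, the other is added to Waiter's graph. Waiter wins when Client's graph contains a $K_3$-factor. Good/bad components: when a new connected component is created in Client's graph it is initially called bad. Whenever Client adds an edge $ab$ to his graph, the status of the component containing $ab$ is updated: (1) if both $a$ and $b$ already lie in good components (the same or different ones), the new component is good; (2) if $ab$ joins a good and a bad component, or adds a new vertex to a good component, the new component is good; (3) if neither $a$ nor $b$ lay in a good component before $ab$ was added, but after adding $ab$ the component $K$ containing $ab$ has a triangle-factor (vertex-disjoint triangles covering $V(K)$) and satisfies $|E(K)| = \frac{4}{3}|V(K)|-1$, then the component is good, and in this case (and only this case) the component is said to be declared good (a new good component is created); (4) otherwise the component containing $ab$ is bad. An edge offered by Waiter to Client is called crucial if, were Client to add it to his graph, a new good connected component would be created (declared good). -}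

module Defs where

open import Level using (0ℓ)
open import Data.Nat using (ℕ; _+_; _*_)
open import Data.Fin using (Fin)
open import Data.Product using (Σ; _×_; _,_; proj₁)
open import Data.Sum using (_⊎_)
open import Data.Empty using (⊥)
open import Data.Unit using (⊤)
open import Data.List using (List; []; _∷_; length; concatMap)
open import Data.List.Membership.Propositional using (_∈_)
open import Data.List.Relation.Unary.All using (All)
open import Data.List.Relation.Unary.Unique.Propositional using (Unique)
open import Relation.Binary.PropositionalEquality using (_≡_; _≢_)
open import Relation.Binary.Construct.Closure.ReflexiveTransitive using (Star)
open import Relation.Nullary using (¬_)

module _ {n : ℕ} where

  -- Vertices of K_n are Fin n.  An edge is stored as an ordered pair,
  -- but is understood as the unordered pair {u , v}.
  Edge : Set
  Edge = Fin n × Fin n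

  Graph : Set
  Graph = List Edge

  SameEdge : Edge → Edge → Set
  SameEdge (a , b) (c , d) = (a ≡ c × b ≡ d) ⊎ (a ≡ d × b ≡ c)

  Adj : Graph → Fin n → Fin n → Set
  Adj G u v = (u , v) ∈ G ⊎ (v , u) ∈ G

  Conn : Graph → Fin n → Fin n → Set
  Conn G = Star (Adj G)

  CardIs : {A : Set} → (A → Set) → ℕ → Set
  CardIs {A} P m = Σ (List A) λ xs →
    Unique xs × (∀ x → x ∈ xs → P x) × (∀ x → P x → x ∈ xs) × length xs ≡ m

  Triple : Set
  Triple = Fin n × Fin n × Fin n

  verts : List Triple → List (Fin n)
  verts = concatMap (λ { (x , y , z) → x ∷ y ∷ z ∷ [] })

  IsTriangle : Graph → Triple → Set
  IsTriangle G (x , y , z) = Adj G x y × Adj G y z × Adj G x z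

  TriangleFactorOn : Graph → (Fin n → Set) → Set
  TriangleFactorOn G K = Σ (List Triple) λ ts →
    All (IsTriangle G) ts × Unique (verts ts) ×
    (∀ v → v ∈ verts ts → K v) × (∀ v → K v → v ∈ verts ts)

  HasK3Factor : Graph → Set
  HasK3Factor G = TriangleFactorOn G (λ _ → ⊤)

  -- the component of G containing a has a triangle-factor and
  -- 3 |E(K)| = 4 |V(K)| - 3, i.e. |E(K)| = (4/3)|V(K)| - 1
  DeclarableAt : Graph → Fin n → Set
  DeclarableAt G a =
    TriangleFactorOn G (Conn G a) ×
    Σ ℕ λ nv → Σ ℕ λ ne →
      CardIs (Conn G a) nv ×
      CardIs (λ (e : Edge) → e ∈ G × Conn G a (proj₁ e)) ne ×
      3 * ne + 3 ≡ 4 * nv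

  Unclaimed : Graph → Graph → Edge → Set
  Unclaimed C W (u , v) = u ≢ v × ¬ Adj C u v × ¬ Adj W u v

  -- Status after Client adds ab: vertex v is good iff it was good, or it lies in
  -- the new component containing ab and this component becomes good
  -- (rules (1),(2): a or b was in a good component; rule (3): declared good).
  -- Otherwise statuses are unchanged (the merged component is bad).
  UpdGood : Graph → (Fin n → Set) → Edge → (Fin n → Set)
  UpdGood C good (a , b) v =
    good v ⊎ (Conn ((a , b) ∷ C) a v × (good a ⊎ good b ⊎ DeclarableAt ((a , b) ∷ C) a))

  -- Reachable positions (Client graph, Waiter graph, good-vertex predicate)
  -- of the unbiased Waiter-Client game on K_n.  A round is played only while
  -- Waiter has not yet won (Client's graph has no K_3-factor): Waiter offers
  -- two distinct unclaimed edges, Client takes one, Waiter gets the other.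
  data Reachable : Graph → Graph → (Fin n → Set) → Set₁ where
    start : Reachable [] [] (λ _ → ⊥)
    round : ∀ {C W good} (e f : Edge) →
      Reachable C W good →
      ¬ HasK3Factor C →
      Unclaimed C W e → Unclaimed C W f → ¬ SameEdge e f →
      Reachable (e ∷ C) (f ∷ W) (UpdGood C good e)

  -- Crucial edge: unclaimed, and adding it to Client's graph creates a new
  -- good component via rule (3) (neither endpoint in a good component).
  Crucial : Graph → Graph → (Fin n → Set) → Edge → Set
  Crucial C W good (a , b) =
    Unclaimed C W (a , b) × ¬ good a × ¬ good b × DeclarableAt ((a , b) ∷ C) a

{-# OPTIONS --safe #-}
-- Let K be the component of c.  Adding a crucial edge ab makes K declarable, with a
-- triangle factor of k triangles; the triangles carry 3k edges, and |E(K)| = 4k - 1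
-- leaves just k - 1 edges between different triangles, so the triangles are linked like
-- the vertices of a tree and every edge of K that is not a bridge lies inside a factor
-- triangle.  As a and b are already connected in C, ab is such an edge, and so are the
-- edges of every triangle of C in K; hence each triangle of C in K is a factor triangle,
-- and a, b lie on no triangle of C.  Now let a'b' be crucial too.  In the factor created
-- by a'b' the triangles through a and through b are not triangles of C, so both use the
-- new edge and contain a'; being disjoint or equal, they coincide.  Thus a and b are
-- adjacent in C + a'b' but not in C, which forces ab = a'b'.
module Submission where

open import Defs
open import Data.Nat using (ℕ; zero; suc; _+_; _*_; _≤_; _<_; z≤n; s≤s)
import Data.Nat as ℕ
open import Data.Nat.Properties
  using (module ≤-Reasoning; ≤-refl; ≤-trans; ≤-reflexive; <-irrefl; m<m+n; suc-injective; 0≢1+n;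
         +-suc; +-identityʳ; +-mono-≤; +-monoˡ-≤; *-monoʳ-≤; *-suc)
open import Data.Nat.Divisibility using (_∣_)
open import Data.Nat.Tactic.RingSolver using (solve)
open import Data.Fin using (Fin)
import Data.Fin.Properties as Fin
open import Data.List using (List; []; _∷_; [_]; length; map; filter; deduplicate; upTo; _++_)
open import Data.List.Properties using (filter-++; filter-accept; filter-reject; length-++; length-upTo)
open import Data.List.Membership.Propositional using (_∈_; _∉_)
import Data.List.Membership.DecPropositional as DecMembership
open import Data.List.Membership.Propositional.Properties
  using (∈-map⁺; ∈-map⁻; ∈-deduplicate⁺; ∈-deduplicate⁻; ∈-filter⁺; ∈-upTo⁻; ∈-∃++; ∈-++⁻; ∈-++⁺ˡ; ∈-++⁺ʳ)
open import Data.List.Relation.Binary.Subset.Propositional using (_⊆_)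
open import Data.List.Relation.Unary.Any using (here; there)
open import Data.List.Relation.Unary.All using (All; []; _∷_)
import Data.List.Relation.Unary.All as All
open import Data.List.Relation.Unary.All.Properties using (¬Any⇒All¬)
open import Data.List.Relation.Unary.AllPairs using ([]; _∷_)
open import Data.List.Relation.Unary.Unique.Propositional using (Unique)
open import Data.List.Relation.Unary.Unique.Propositional.Properties using (upTo⁺)
open import Data.List.Relation.Unary.Unique.DecPropositional.Properties using (deduplicate-!)
open import Data.Product using (Σ; _×_; _,_; _,′_; proj₁; proj₂)
open import Data.Product.Properties using (≡-dec)
open import Data.Sum using (_⊎_; inj₁; inj₂)
open import Data.Empty using (⊥-elim)
open import Function using (_∘_; case_of_)
open import Relation.Binary.Definitions using (DecidableEquality)
open import Relation.Binary.PropositionalEquality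
  using (_≡_; _≢_; refl; sym; trans; cong; cong₂; subst; subst₂; module ≡-Reasoning)
open import Relation.Binary.Construct.Closure.ReflexiveTransitive using (ε; _◅_; _◅◅_)
open import Relation.Nullary using (¬_; Dec; yes; no)
open import Relation.Nullary.Decidable using (¬?)

-- Pigeonhole for duplicate-free lists

module _ {A : Set} (_≟_ : DecidableEquality A) where

  open DecMembership _≟_ using (_∈?_)

  private
    remove : A → List A → List A
    remove y [] = []
    remove y (z ∷ zs) with y ≟ z
    ... | yes _ = zs
    ... | no _ = z ∷ remove y zs

    length-remove : ∀ {y zs} → y ∈ zs → suc (length (remove y zs)) ≡ length zs
    length-remove {y} {z ∷ zs} y∈ with y ≟ z | y∈
    ... | yes _  | _          = refl
    ... | no y≢z | here y≡z   = ⊥-elim (y≢z y≡z)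
    ... | no _   | there y∈zs = cong suc (length-remove y∈zs)

    ∈-remove : ∀ {y w zs} → w ∈ zs → w ≢ y → w ∈ remove y zs
    ∈-remove {y} {w} {z ∷ zs} w∈ w≢y with y ≟ z | w∈
    ... | yes refl | here w≡y    = ⊥-elim (w≢y w≡y)
    ... | yes _    | there w∈zs = w∈zs
    ... | no _     | here w≡z    = here w≡z
    ... | no _     | there w∈zs = there (∈-remove w∈zs w≢y)

  Unique-length-mono-⊆ : ∀ {xs ys} → Unique xs → xs ⊆ ys → length xs ≤ length ys
  Unique-length-mono-⊆ {[]}     _             _  = z≤n
  Unique-length-mono-⊆ {x ∷ xs} {ys} (x∉xs ∷ u) xs⊆ys =
    subst (suc (length xs) ≤_) (length-remove (xs⊆ys (here refl)))
      (s≤s (Unique-length-mono-⊆ u λ w∈ →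
        ∈-remove (xs⊆ys (there w∈)) λ w≡x → All.lookup x∉xs w∈ (sym w≡x)))

  Unique-⊆-length≥⇒⊇ : ∀ {xs ys} → Unique xs → xs ⊆ ys → length ys ≤ length xs → ys ⊆ xs
  Unique-⊆-length≥⇒⊇ {xs} {ys} xs! xs⊆ys ys≤xs {w} w∈ys with w ∈? xs
  ... | yes w∈xs = w∈xs
  ... | no w∉xs  = ⊥-elim (<-irrefl refl (≤-trans longer ys≤xs))
    where
    longer : suc (length xs) ≤ length ys
    longer = Unique-length-mono-⊆ (¬Any⇒All¬ xs w∉xs ∷ xs!) λ where
      (here refl) → w∈ys
      (there v∈)  → xs⊆ys v∈

module _ {A : Set} where

  #values : (A → ℕ) → List A → ℕ
  #values f vs = length (deduplicate ℕ._≟_ (map f vs))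

  Unique-⊆-image⇒≤#values : ∀ f vs {ws} → Unique ws → ws ⊆ map f vs → length ws ≤ #values f vs
  Unique-⊆-image⇒≤#values f vs u ws⊆ =
    Unique-length-mono-⊆ ℕ._≟_ u (λ w∈ → ∈-deduplicate⁺ ℕ._≟_ (ws⊆ w∈))

  #values-const : ∀ f vs k → (∀ {v} → v ∈ vs → f v ≡ k) → #values f vs ≤ 1
  #values-const f vs k f≡k =
    Unique-length-mono-⊆ ℕ._≟_ {ys = k ∷ []} (deduplicate-! ℕ._≟_ (map f vs)) λ w∈ →
      let v , v∈ , w≡fv = ∈-map⁻ f (∈-deduplicate⁻ ℕ._≟_ (map f vs) w∈)
      in here (trans w≡fv (f≡k v∈))

  #values-≤-suc : ∀ f g vs β → (∀ x → f x ≢ β → g x ≡ f x) → #values f vs ≤ suc (#values g vs)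
  #values-≤-suc f g vs β g≗f =
    Unique-length-mono-⊆ ℕ._≟_ {ys = β ∷ deduplicate ℕ._≟_ (map g vs)}
      (deduplicate-! ℕ._≟_ (map f vs)) λ w∈ →
      let v , v∈ , w≡fv = ∈-map⁻ f (∈-deduplicate⁻ ℕ._≟_ (map f vs) w∈)
      in case f v ℕ.≟ β of λ where
        (yes fv≡β) → here (trans w≡fv fv≡β)
        (no fv≢β)  → there (∈-deduplicate⁺ ℕ._≟_
                       (subst (_∈ map g vs) (trans (g≗f v fv≢β) (sym w≡fv)) (∈-map⁺ g v∈)))

-- Colourings and crossing edges

module _ {V : Set} where

  Colouring : Set
  Colouring = V → ℕ

  Monochromatic : Colouring → V × V → Set
  Monochromatic c (u , v) = c u ≡ c v

  monochromatic? : ∀ c e → Dec (Monochromatic c e)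
  monochromatic? c (u , v) = c u ℕ.≟ c v

  crossing : Colouring → List (V × V) → ℕ
  crossing c L = length (filter (¬? ∘ monochromatic? c) L)

  length≡mono+crossing : ∀ c L → length L ≡ length (filter (monochromatic? c) L) + crossing c L
  length≡mono+crossing c [] = refl
  length≡mono+crossing c (e ∷ L) with monochromatic? c e
  ... | yes mono = trans (cong suc (length≡mono+crossing c L)) (sym (cong₂ _+_
          (cong length (filter-accept (monochromatic? c) mono))
          (cong length (filter-reject (¬? ∘ monochromatic? c) (λ ¬mono → ¬mono mono)))))
  ... | no ¬mono = trans (cong suc (length≡mono+crossing c L)) (sym (trans (cong₂ _+_
          (cong length (filter-reject (monochromatic? c) ¬mono))
          (cong length (filter-accept (¬? ∘ monochromatic? c) ¬mono))) (+-suc _ _)))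

  crossing-++ : ∀ c L M → crossing c (L ++ M) ≡ crossing c L + crossing c M
  crossing-++ c L M = trans (cong length (filter-++ (¬? ∘ monochromatic? c) L M)) (length-++ (filter _ L))

  crossing-∷-monochromatic : ∀ c {e} L → Monochromatic c e → crossing c (e ∷ L) ≡ crossing c L
  crossing-∷-monochromatic c L mono =
    cong length (filter-reject (¬? ∘ monochromatic? c) (λ ¬mono → ¬mono mono))

  crossing-∷-bichromatic : ∀ c {e} L → ¬ Monochromatic c e → crossing c (e ∷ L) ≡ suc (crossing c L)
  crossing-∷-bichromatic c L ¬mono = cong length (filter-accept (¬? ∘ monochromatic? c) ¬mono)

  recolour : ℕ → ℕ → ℕ → ℕ
  recolour α β w with w ℕ.≟ β
  ... | yes _ = α
  ... | no _  = w

  recolour-β : ∀ α β → recolour α β β ≡ α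
  recolour-β α β with β ℕ.≟ β
  ... | yes _ = refl
  ... | no β≢β = ⊥-elim (β≢β refl)

  recolour-α : ∀ α β → recolour α β α ≡ α
  recolour-α α β with α ℕ.≟ β
  ... | yes _ = refl
  ... | no _  = refl

  recolour-≢ : ∀ α {β w} → w ≢ β → recolour α β w ≡ w
  recolour-≢ α {β} {w} w≢β with w ℕ.≟ β
  ... | yes w≡β = ⊥-elim (w≢β w≡β)
  ... | no _    = refl

  -- Merge the two colour classes at the ends of each crossing edge in turn
  -- (a union–find run): every merge destroys at most one colour.
  merge-along : ∀ (c₀ : Colouring) vs L → Σ Colouring λ c →
    All (Monochromatic c) L × (∀ x y → c₀ x ≡ c₀ y → c x ≡ c y) ×
    #values c₀ vs ≤ #values c vs + crossing c₀ L
  merge-along c₀ vs [] = c₀ , [] , (λ _ _ eq → eq) , ≤-reflexive (sym (+-identityʳ _))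
  merge-along c₀ vs ((u , v) ∷ L) with merge-along c₀ vs L | c₀ u ℕ.≟ c₀ v
  ... | c , mono , refines , bound | yes c₀u≡c₀v =
    c , refines u v c₀u≡c₀v ∷ mono , refines ,
    subst (λ k → _ ≤ _ + k) (sym (crossing-∷-monochromatic c₀ L c₀u≡c₀v)) bound
  ... | c , mono , refines , bound | no c₀u≢c₀v =
    c′ , merged ∷ All.map (cong (recolour (c u) (c v))) mono ,
    (λ x y eq → cong (recolour (c u) (c v)) (refines x y eq)) , bound′
    where
    c′ : Colouring
    c′ x = recolour (c u) (c v) (c x)
    merged : c′ u ≡ c′ v
    merged = trans (recolour-α (c u) (c v)) (sym (recolour-β (c u) (c v)))
    bound′ : #values c₀ vs ≤ #values c′ vs + crossing c₀ ((u , v) ∷ L)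
    bound′ = begin
      #values c₀ vs                             ≤⟨ bound ⟩
      #values c vs + crossing c₀ L              ≤⟨ +-monoˡ-≤ (crossing c₀ L) (#values-≤-suc c c′ vs (c v) λ _ → recolour-≢ (c u)) ⟩
      suc (#values c′ vs) + crossing c₀ L       ≡⟨ sym (+-suc (#values c′ vs) (crossing c₀ L)) ⟩
      #values c′ vs + suc (crossing c₀ L)       ≡⟨ cong (#values c′ vs +_) (sym (crossing-∷-bichromatic c₀ L c₀u≢c₀v)) ⟩
      #values c′ vs + crossing c₀ ((u , v) ∷ L) ∎
      where open ≤-Reasoning

  -- A connected graph on m colour classes has at least m - 1 crossing edges; here e₀ is one more.
  #values≤crossing : ∀ c₀ vs xs {e₀} r → e₀ ∈ xs → ¬ Monochromatic c₀ e₀ →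
    (∀ c → (∀ {e} → e ∈ xs → e ≢ e₀ → Monochromatic c e) → ∀ {v} → v ∈ vs → c v ≡ c r) →
    #values c₀ vs ≤ crossing c₀ xs
  #values≤crossing c₀ vs xs {e₀} r e₀∈ ¬mono merged with ∈-∃++ e₀∈
  ... | pre , suf , refl with merge-along c₀ vs (pre ++ suf)
  ... | c , mono , _ , bound = begin
    #values c₀ vs                            ≤⟨ bound ⟩
    #values c vs + crossing c₀ (pre ++ suf)  ≤⟨ +-monoˡ-≤ _ (#values-const c vs (c r) (merged c except-e₀)) ⟩
    1 + crossing c₀ (pre ++ suf)             ≡⟨ cong suc (crossing-++ c₀ pre suf) ⟩
    suc (crossing c₀ pre + crossing c₀ suf)  ≡⟨ sym (+-suc _ _) ⟩
    crossing c₀ pre + suc (crossing c₀ suf)  ≡⟨ cong (crossing c₀ pre +_) (sym (crossing-∷-bichromatic c₀ suf ¬mono)) ⟩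
    crossing c₀ pre + crossing c₀ (e₀ ∷ suf) ≡⟨ sym (crossing-++ c₀ pre (e₀ ∷ suf)) ⟩
    crossing c₀ (pre ++ e₀ ∷ suf)            ∎
    where
    open ≤-Reasoning
    except-e₀ : ∀ {e} → e ∈ pre ++ e₀ ∷ suf → e ≢ e₀ → Monochromatic c e
    except-e₀ e∈ e≢e₀ with ∈-++⁻ pre e∈
    ... | inj₁ e∈pre         = All.lookup mono (∈-++⁺ˡ e∈pre)
    ... | inj₂ (here e≡e₀)   = ⊥-elim (e≢e₀ e≡e₀)
    ... | inj₂ (there e∈suf) = All.lookup mono (∈-++⁺ʳ pre e∈suf)

-- Triangle factors

module _ {n : ℕ} where

  open DecMembership (Fin._≟_ {n}) using (_∈?_)

  corners : Triple {n} → List (Fin n)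
  corners (x , y , z) = x ∷ y ∷ z ∷ []

  ∈-verts⁺ : ∀ {T ts} {v : Fin n} → T ∈ ts → v ∈ corners T → v ∈ verts ts
  ∈-verts⁺ {ts = (x , y , z) ∷ ts} (here refl)  v∈T = ∈-++⁺ˡ v∈T
  ∈-verts⁺ {ts = (x , y , z) ∷ ts} (there T∈ts) v∈T = ∈-++⁺ʳ (x ∷ y ∷ z ∷ []) (∈-verts⁺ T∈ts v∈T)

  ∈-verts⁻ : ∀ {ts} {v : Fin n} → v ∈ verts ts → Σ (Triple {n}) λ T → T ∈ ts × v ∈ corners T
  ∈-verts⁻ {(x , y , z) ∷ ts} v∈ with ∈-++⁻ (x ∷ y ∷ z ∷ []) v∈
  ... | inj₁ v∈t  = (x , y , z) , here refl , v∈t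
  ... | inj₂ v∈ts = let T , T∈ , v∈T = ∈-verts⁻ v∈ts in T , there T∈ , v∈T

  length-verts : ∀ ts → length (verts {n} ts) ≡ 3 * length ts
  length-verts []                 = refl
  length-verts ((x , y , z) ∷ ts) =
    trans (cong (λ m → suc (suc (suc m))) (length-verts ts)) (sym (*-suc 3 (length ts)))

  Unique-verts-tail : ∀ t ts → Unique (verts {n} (t ∷ ts)) → Unique (verts ts)
  Unique-verts-tail (x , y , z) ts (_ ∷ _ ∷ _ ∷ ts!) = ts!

  corner∉verts-tail : ∀ t ts {v : Fin n} → Unique (verts (t ∷ ts)) → v ∈ corners t → v ∉ verts ts
  corner∉verts-tail (x , y , z) ts (x∉ ∷ _ ∷ _ ∷ _) (here refl)                 v∈ =
    All.lookup x∉ (there (there v∈)) refl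
  corner∉verts-tail (x , y , z) ts (_ ∷ y∉ ∷ _ ∷ _) (there (here refl))         v∈ =
    All.lookup y∉ (there v∈) refl
  corner∉verts-tail (x , y , z) ts (_ ∷ _ ∷ z∉ ∷ _) (there (there (here refl))) v∈ =
    All.lookup z∉ v∈ refl

  triangleIndex : List (Triple {n}) → Fin n → ℕ
  triangleIndex []       v = 0
  triangleIndex (t ∷ ts) v with v ∈? corners t
  ... | yes _ = 0
  ... | no _  = suc (triangleIndex ts v)

  triangleIndex-head : ∀ {t} ts {v} → v ∈ corners t → triangleIndex (t ∷ ts) v ≡ 0
  triangleIndex-head {t} ts {v} v∈t with v ∈? corners t
  ... | yes _  = refl
  ... | no v∉t = ⊥-elim (v∉t v∈t)

  triangleIndex-tail : ∀ {t} ts {v} → v ∉ corners t → triangleIndex (t ∷ ts) v ≡ suc (triangleIndex ts v)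
  triangleIndex-tail {t} ts {v} v∉t with v ∈? corners t
  ... | yes v∈t = ⊥-elim (v∉t v∈t)
  ... | no _    = refl

  triangleIndex-tail-corner : ∀ t ts {T v} → Unique (verts (t ∷ ts)) → T ∈ ts → v ∈ corners T →
    triangleIndex (t ∷ ts) v ≡ suc (triangleIndex ts v)
  triangleIndex-tail-corner t ts ts! T∈ v∈T =
    triangleIndex-tail ts (λ v∈t → corner∉verts-tail t ts ts! v∈t (∈-verts⁺ T∈ v∈T))

  triangleIndex-corners : ∀ ts {T v w} → Unique (verts ts) → T ∈ ts → v ∈ corners T → w ∈ corners T →
    triangleIndex ts v ≡ triangleIndex ts w
  triangleIndex-corners (t ∷ ts) _ (here refl) v∈ w∈ =
    trans (triangleIndex-head ts v∈) (sym (triangleIndex-head ts w∈))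
  triangleIndex-corners (t ∷ ts) {v = v} {w} ts! (there T∈) v∈ w∈ = begin
    triangleIndex (t ∷ ts) v ≡⟨ triangleIndex-tail-corner t ts ts! T∈ v∈ ⟩
    suc (triangleIndex ts v) ≡⟨ cong suc (triangleIndex-corners ts (Unique-verts-tail t ts ts!) T∈ v∈ w∈) ⟩
    suc (triangleIndex ts w) ≡⟨ sym (triangleIndex-tail-corner t ts ts! T∈ w∈) ⟩
    triangleIndex (t ∷ ts) w ∎
    where open ≡-Reasoning

  sameIndex⇒corner : ∀ ts {T v w} → Unique (verts ts) → T ∈ ts → v ∈ corners T →
    triangleIndex ts w ≡ triangleIndex ts v → w ∈ corners T
  sameIndex⇒corner (t ∷ ts) {v = v} {w} ts! T∈ v∈T w~v = case ((w ∈? corners t) ,′ T∈) of λ where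
      (yes w∈t , here refl)  → w∈t
      (yes w∈t , there T∈ts) →
        ⊥-elim (0≢1+n (trans (sym (triangleIndex-head ts w∈t))
                             (trans w~v (triangleIndex-tail-corner t ts ts! T∈ts v∈T))))
      (no w∉t , here refl)   →
        ⊥-elim (0≢1+n (trans (sym (triangleIndex-head ts v∈T))
                             (trans (sym w~v) (triangleIndex-tail ts w∉t))))
      (no w∉t , there T∈ts)  → sameIndex⇒corner ts (Unique-verts-tail t ts ts!) T∈ts v∈T (suc-injective (begin
        suc (triangleIndex ts w) ≡⟨ sym (triangleIndex-tail ts w∉t) ⟩
        triangleIndex (t ∷ ts) w ≡⟨ w~v ⟩
        triangleIndex (t ∷ ts) v ≡⟨ triangleIndex-tail-corner t ts ts! T∈ts v∈T ⟩
        suc (triangleIndex ts v) ∎))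
    where open ≡-Reasoning

  sharedCorner⇒corners-⊆ : ∀ ts {T T′ v} → Unique (verts ts) → T ∈ ts → T′ ∈ ts →
    v ∈ corners T → v ∈ corners T′ → corners T′ ⊆ corners T
  sharedCorner⇒corners-⊆ ts ts! T∈ T′∈ v∈T v∈T′ w∈T′ =
    sameIndex⇒corner ts ts! T∈ v∈T (triangleIndex-corners ts ts! T′∈ w∈T′ v∈T′)

  triangleIndex-image : ∀ ts {i} → Unique (verts ts) → i < length ts →
    Σ (Fin n) λ v → v ∈ verts ts × triangleIndex ts v ≡ i
  triangleIndex-image ((x , y , z) ∷ ts) {zero} _ _ = x , here refl , triangleIndex-head ts (here refl)
  triangleIndex-image (t ∷ ts) {suc i} ts! (s≤s i<)
    with triangleIndex-image ts (Unique-verts-tail t ts ts!) i<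
  ... | v , v∈ , v↦i = v , ∈-++⁺ʳ (corners t) v∈ ,
        trans (triangleIndex-tail ts (λ v∈t → corner∉verts-tail t ts ts! v∈t v∈)) (cong suc v↦i)

-- Graphs as edge lists

module _ {n : ℕ} where

  Loopless : Graph {n} → Set
  Loopless G = ∀ {u v} → (u , v) ∈ G → u ≢ v

  Adj-sym : ∀ {G : Graph {n}} {u v} → Adj G u v → Adj G v u
  Adj-sym (inj₁ uv∈) = inj₂ uv∈
  Adj-sym (inj₂ vu∈) = inj₁ vu∈

  Adj-irrefl : ∀ {G : Graph {n}} → Loopless G → ∀ {u v} → Adj G u v → u ≢ v
  Adj-irrefl G! (inj₁ uv∈) = G! uv∈
  Adj-irrefl G! (inj₂ vu∈) = G! vu∈ ∘ sym

  Adj-weaken : ∀ {G : Graph {n}} {e u v} → Adj G u v → Adj (e ∷ G) u v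
  Adj-weaken (inj₁ uv∈) = inj₁ (there uv∈)
  Adj-weaken (inj₂ vu∈) = inj₂ (there vu∈)

  Conn-snoc : ∀ {G : Graph {n}} {u v w} → Conn G u v → Adj G v w → Conn G u w
  Conn-snoc u~v vw = u~v ◅◅ (vw ◅ ε)

  Conn-sym : ∀ {G : Graph {n}} {u v} → Conn G u v → Conn G v u
  Conn-sym ε          = ε
  Conn-sym (uw ◅ w~v) = Conn-snoc (Conn-sym w~v) (Adj-sym uw)

  Conn-weaken : ∀ {G : Graph {n}} {e u v} → Conn G u v → Conn (e ∷ G) u v
  Conn-weaken ε          = ε
  Conn-weaken (uw ◅ w~v) = Adj-weaken uw ◅ Conn-weaken w~v

  edgeOf : ∀ {G : Graph {n}} {p q} → Adj G p q → Edge {n}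
  edgeOf {p = p} {q} (inj₁ _) = p , q
  edgeOf {p = p} {q} (inj₂ _) = q , p

  edgeOf-∈ : ∀ {G : Graph {n}} {p q} (pq : Adj G p q) → edgeOf pq ∈ G
  edgeOf-∈ (inj₁ pq∈) = pq∈
  edgeOf-∈ (inj₂ qp∈) = qp∈

  edgeOf-same : ∀ {G : Graph {n}} {p q} (pq : Adj G p q) → SameEdge (edgeOf pq) (p , q)
  edgeOf-same (inj₁ _) = inj₁ (refl , refl)
  edgeOf-same (inj₂ _) = inj₂ (refl , refl)

  Conn-edgeOf : ∀ {H : Graph {n}} {r p q} → Conn H r p → (pq : Adj H p q) → Conn H r (proj₁ (edgeOf pq))
  Conn-edgeOf r~p (inj₁ _)   = r~p
  Conn-edgeOf r~p (inj₂ qp∈) = Conn-snoc r~p (inj₂ qp∈)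

  edgeOf-weaken : ∀ {G : Graph {n}} {e p q} (pq : Adj G p q) → edgeOf (Adj-weaken {e = e} pq) ≡ edgeOf pq
  edgeOf-weaken (inj₁ _) = refl
  edgeOf-weaken (inj₂ _) = refl

  SameEdge-swap : ∀ {e : Edge {n}} {p q} → SameEdge e (p , q) → SameEdge e (q , p)
  SameEdge-swap (inj₁ same) = inj₂ same
  SameEdge-swap (inj₂ swapped) = inj₁ swapped

  SameEdge-corners : ∀ {e : Edge {n}} {p q cs} → SameEdge e (p , q) → p ∈ cs → q ∈ cs →
    proj₁ e ∈ cs × proj₂ e ∈ cs
  SameEdge-corners (inj₁ (refl , refl)) p∈ q∈ = p∈ , q∈
  SameEdge-corners (inj₂ (refl , refl)) p∈ q∈ = q∈ , p∈

  SameEdge-distinct : ∀ {e e′ : Edge {n}} {p q p′ q′} → SameEdge e (p , q) → SameEdge e′ (p′ , q′) →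
    p ≢ p′ → p ≢ q′ → e ≢ e′
  SameEdge-distinct (inj₁ (refl , _)) (inj₁ (refl , _)) p≢p′ _ refl = p≢p′ refl
  SameEdge-distinct (inj₁ (refl , _)) (inj₂ (refl , _)) _ p≢q′ refl = p≢q′ refl
  SameEdge-distinct (inj₂ (_ , refl)) (inj₁ (_ , refl)) _ p≢q′ refl = p≢q′ refl
  SameEdge-distinct (inj₂ (_ , refl)) (inj₂ (_ , refl)) p≢p′ _ refl = p≢p′ refl

  triangle-adj : ∀ {G : Graph {n}} {T p q} → IsTriangle G T → p ∈ corners T → q ∈ corners T → p ≢ q → Adj G p q
  triangle-adj _            (here refl)                 (here refl)                 p≢q = ⊥-elim (p≢q refl)
  triangle-adj (xy , _ , _) (here refl)                 (there (here refl))         _   = xy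
  triangle-adj (_ , _ , xz) (here refl)                 (there (there (here refl))) _   = xz
  triangle-adj (xy , _ , _) (there (here refl))         (here refl)                 _   = Adj-sym xy
  triangle-adj _            (there (here refl))         (there (here refl))         p≢q = ⊥-elim (p≢q refl)
  triangle-adj (_ , yz , _) (there (here refl))         (there (there (here refl))) _   = yz
  triangle-adj (_ , _ , xz) (there (there (here refl))) (here refl)                 _   = Adj-sym xz
  triangle-adj (_ , yz , _) (there (there (here refl))) (there (here refl))         _   = Adj-sym yz
  triangle-adj _            (there (there (here refl))) (there (there (here refl))) p≢q = ⊥-elim (p≢q refl)

  triangleEdges : ∀ {G : Graph {n}} {ts} → All (IsTriangle G) ts → List (Edge {n})
  triangleEdges []                    = []
  triangleEdges ((xy , yz , xz) ∷ τs) = edgeOf xy ∷ edgeOf yz ∷ edgeOf xz ∷ triangleEdges τs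

  length-triangleEdges : ∀ {G : Graph {n}} {ts} (τs : All (IsTriangle G) ts) →
    length (triangleEdges τs) ≡ 3 * length ts
  length-triangleEdges []                     = refl
  length-triangleEdges {ts = _ ∷ ts} (_ ∷ τs) =
    trans (cong (λ m → suc (suc (suc m))) (length-triangleEdges τs)) (sym (*-suc 3 (length ts)))

  triangleEdges-⊆ : ∀ {G : Graph {n}} {ts} (τs : All (IsTriangle G) ts) {e} → e ∈ triangleEdges τs → e ∈ G
  triangleEdges-⊆ ((xy , _ , _) ∷ _)  (here refl)                 = edgeOf-∈ xy
  triangleEdges-⊆ ((_ , yz , _) ∷ _)  (there (here refl))         = edgeOf-∈ yz
  triangleEdges-⊆ ((_ , _ , xz) ∷ _)  (there (there (here refl))) = edgeOf-∈ xz
  triangleEdges-⊆ (_ ∷ τs) (there (there (there e∈)))             = triangleEdges-⊆ τs e∈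

  triangleEdges-corners : ∀ {G : Graph {n}} {ts} (τs : All (IsTriangle G) ts) {e} → e ∈ triangleEdges τs →
    Σ (Triple {n}) λ T → T ∈ ts × proj₁ e ∈ corners T × proj₂ e ∈ corners T
  triangleEdges-corners {ts = t ∷ _} ((xy , _ , _) ∷ _) (here refl) =
    t , here refl , SameEdge-corners (edgeOf-same xy) (here refl) (there (here refl))
  triangleEdges-corners {ts = t ∷ _} ((_ , yz , _) ∷ _) (there (here refl)) =
    t , here refl , SameEdge-corners (edgeOf-same yz) (there (here refl)) (there (there (here refl)))
  triangleEdges-corners {ts = t ∷ _} ((_ , _ , xz) ∷ _) (there (there (here refl))) =
    t , here refl , SameEdge-corners (edgeOf-same xz) (here refl) (there (there (here refl)))
  triangleEdges-corners (_ ∷ τs) (there (there (there e∈))) =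
    let T , T∈ , e₁∈ , e₂∈ = triangleEdges-corners τs e∈ in T , there T∈ , e₁∈ , e₂∈

  Unique-triangleEdges : ∀ {G : Graph {n}} {ts} (τs : All (IsTriangle G) ts) →
    Unique (verts ts) → Unique (triangleEdges τs)
  Unique-triangleEdges [] _ = []
  Unique-triangleEdges {ts = t@(x , y , z) ∷ ts} ((xy , yz , xz) ∷ τs) vs!@(x∉ ∷ y∉ ∷ _ ∷ ts!) =
    (xy≢yz ∷ xy≢xz ∷ away (first-corner xy x∈ y∈)) ∷
    (yz≢xz ∷ away (first-corner yz y∈ z∈)) ∷
    away (first-corner xz x∈ z∈) ∷
    Unique-triangleEdges τs ts!
    where
    x∈ : x ∈ corners t
    x∈ = here refl
    y∈ : y ∈ corners t
    y∈ = there (here refl)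
    z∈ : z ∈ corners t
    z∈ = there (there (here refl))
    x≢y : x ≢ y
    x≢y = All.head x∉
    x≢z : x ≢ z
    x≢z = All.lookup x∉ (there (here refl))
    y≢z : y ≢ z
    y≢z = All.head y∉
    xy≢yz = SameEdge-distinct (edgeOf-same xy) (edgeOf-same yz) x≢y x≢z
    xy≢xz = SameEdge-distinct (SameEdge-swap (edgeOf-same xy)) (edgeOf-same xz) (x≢y ∘ sym) y≢z
    yz≢xz = SameEdge-distinct (edgeOf-same yz) (edgeOf-same xz) (x≢y ∘ sym) y≢z
    first-corner : ∀ {p q} (pq : Adj _ p q) → p ∈ corners t → q ∈ corners t → proj₁ (edgeOf pq) ∈ corners t
    first-corner pq p∈ q∈ = proj₁ (SameEdge-corners (edgeOf-same pq) p∈ q∈)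
    away : ∀ {e} → proj₁ e ∈ corners t → All (e ≢_) (triangleEdges τs)
    away e₁∈t = All.tabulate λ e′∈ → λ { refl →
      let T , T∈ , e₁∈T , _ = triangleEdges-corners τs e′∈
      in corner∉verts-tail t ts vs! e₁∈t (∈-verts⁺ T∈ e₁∈T) }

-- Bridges of declarable components

module _ {n : ℕ} where

  edge-≟ : DecidableEquality (Edge {n})
  edge-≟ = ≡-dec Fin._≟_ Fin._≟_

  RespectsExcept : Colouring → Graph {n} → Fin n → Edge {n} → Set
  RespectsExcept c H r e₀ = ∀ {e} → e ∈ H → Conn H r (proj₁ e) → e ≢ e₀ → Monochromatic c e

  -- Connectivity of the component of r without e₀, expressed through colourings:
  -- any colouring that is constant along all its other edges is constant along e₀.
  NonBridge : Graph {n} → Fin n → Edge {n} → Set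
  NonBridge H r e₀ = ∀ c → RespectsExcept c H r e₀ → Monochromatic c e₀

  Monochromatic-same : ∀ {c : Colouring} {e p q} → SameEdge {n} e (p , q) → Monochromatic c e → c p ≡ c q
  Monochromatic-same (inj₁ (refl , refl)) mono = mono
  Monochromatic-same (inj₂ (refl , refl)) mono = sym mono

  Monochromatic-same⁻ : ∀ {c : Colouring} {e p q} → SameEdge {n} e (p , q) → c p ≡ c q → Monochromatic c e
  Monochromatic-same⁻ (inj₁ (refl , refl)) cp≡cq = cp≡cq
  Monochromatic-same⁻ (inj₂ (refl , refl)) cp≡cq = sym cp≡cq

  RespectsExcept-adj : ∀ {c H r e₀ s t} → RespectsExcept c H r e₀ → Conn H r s →
    (st : Adj H s t) → edgeOf st ≢ e₀ → c s ≡ c t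
  RespectsExcept-adj resp r~s (inj₁ st∈) st≢e₀ = resp st∈ r~s st≢e₀
  RespectsExcept-adj resp r~s (inj₂ ts∈) ts≢e₀ = sym (resp ts∈ (Conn-snoc r~s (inj₂ ts∈)) ts≢e₀)

  NonBridge⇒constant : ∀ {c H r e₀ v} → NonBridge H r e₀ → RespectsExcept c H r e₀ → Conn H r v → c r ≡ c v
  NonBridge⇒constant {c} {H} {r} {e₀} nb resp = walk ε
    where
    walk : ∀ {s v} → Conn H r s → Conn H s v → c s ≡ c v
    walk r~s ε = refl
    walk r~s (st ◅ t~v) with edge-≟ (edgeOf st) e₀
    ... | yes refl = trans (Monochromatic-same (edgeOf-same st) (nb c resp)) (walk (Conn-snoc r~s st) t~v)
    ... | no st≢e₀ = trans (RespectsExcept-adj resp r~s st st≢e₀) (walk (Conn-snoc r~s st) t~v)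

  factorOf : ∀ {H r} → DeclarableAt {n} H r → List (Triple {n})
  factorOf D = proj₁ (proj₁ D)

  edges-exceed-declarable : ∀ k ne nv → 3 * k + k ≤ ne → nv ≤ 3 * k → 3 * ne + 3 ≢ 4 * nv
  edges-exceed-declarable k ne nv 4k≤ne nv≤3k eq = <-irrefl (sym eq) (begin-strict
    4 * nv          ≤⟨ *-monoʳ-≤ 4 nv≤3k ⟩
    4 * (3 * k)     ≡⟨ solve [ k ] ⟩
    3 * (3 * k + k) ≤⟨ *-monoʳ-≤ 3 4k≤ne ⟩
    3 * ne          <⟨ m<m+n (3 * ne) (s≤s z≤n) ⟩
    3 * ne + 3      ∎)
    where open ≤-Reasoning

  -- With 3k edges inside the k triangles, 3|E| + 3 = 4|V| ≤ 12k leaves at most k - 1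
  -- crossing edges, one too few if some crossing edge is not a bridge.
  nonBridge-inside-factorTriangle : ∀ {H r e₀} (D : DeclarableAt {n} H r) → e₀ ∈ H → Conn H r (proj₁ e₀) →
    NonBridge H r e₀ → Monochromatic (triangleIndex (factorOf D)) e₀
  nonBridge-inside-factorTriangle {r = r} {e₀}
    ((ts , τs , ts! , ts⊆K , K⊆ts) , nv , ne , (vs , vs! , vs⊆K , K⊆vs , |vs|) ,
     (es , _ , _ , E⊆es , |es|) , count) e₀∈ r~e₀ nb
    with monochromatic? (triangleIndex ts) e₀
  ... | yes mono = mono
  ... | no ¬mono = ⊥-elim (edges-exceed-declarable k ne nv 4k≤ne nv≤3k count)
    where
    k = length ts
    c₀ = triangleIndex ts

    k≤#colours : k ≤ #values c₀ vs
    k≤#colours = subst (_≤ #values c₀ vs) (length-upTo k)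
      (Unique-⊆-image⇒≤#values c₀ vs (upTo⁺ k) λ i∈ →
      let v , v∈ , v↦i = triangleIndex-image ts ts! (∈-upTo⁻ i∈)
      in subst (_∈ map c₀ vs) v↦i (∈-map⁺ c₀ (K⊆vs v (ts⊆K v v∈))))

    #colours≤crossing : #values c₀ vs ≤ crossing c₀ es
    #colours≤crossing = #values≤crossing c₀ vs es r (E⊆es e₀ (e₀∈ , r~e₀)) ¬mono λ c resp {v} v∈ →
      sym (NonBridge⇒constant nb (λ {e} e∈ r~e e≢e₀ → resp (E⊆es e (e∈ , r~e)) e≢e₀) (vs⊆K v v∈))

    3k≤inside : 3 * k ≤ length (filter (monochromatic? c₀) es)
    3k≤inside = subst (_≤ length (filter (monochromatic? c₀) es)) (length-triangleEdges τs)
      (Unique-length-mono-⊆ edge-≟ (Unique-triangleEdges τs ts!) λ {e} e∈ →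
      let T , T∈ , e₁∈T , e₂∈T = triangleEdges-corners τs e∈
      in ∈-filter⁺ (monochromatic? c₀) (E⊆es e (triangleEdges-⊆ τs e∈ , ts⊆K _ (∈-verts⁺ T∈ e₁∈T)))
                   (triangleIndex-corners ts ts! T∈ e₁∈T e₂∈T))

    4k≤ne : 3 * k + k ≤ ne
    4k≤ne = subst (3 * k + k ≤_) (trans (sym (length≡mono+crossing c₀ es)) |es|)
                  (+-mono-≤ 3k≤inside (≤-trans k≤#colours #colours≤crossing))

    nv≤3k : nv ≤ 3 * k
    nv≤3k = subst₂ _≤_ |vs| (length-verts ts) (Unique-length-mono-⊆ Fin._≟_ vs! λ {v} v∈ → K⊆ts v (vs⊆K v v∈))

-- Crucial edges

module _ {n : ℕ} where

  Reachable⇒Loopless : ∀ {C W : Graph {n}} {good} → Reachable C W good → Loopless C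
  Reachable⇒Loopless (round _ _ _ _ (u≢v , _) _ _) (here refl) = u≢v
  Reachable⇒Loopless (round _ _ R _ _ _ _)         (there uv∈) = Reachable⇒Loopless R uv∈

  Loopless-∷ : ∀ {G : Graph {n}} {u v} → u ≢ v → Loopless G → Loopless ((u , v) ∷ G)
  Loopless-∷ u≢v _  (here refl) = u≢v
  Loopless-∷ _   G! (there xy∈) = G! xy∈

  Adj-∷⁻ : ∀ {G : Graph {n}} {p q x y} → Adj ((p , q) ∷ G) x y → Adj G x y ⊎ (x ≡ p ⊎ y ≡ p)
  Adj-∷⁻ (inj₁ (here refl))  = inj₂ (inj₁ refl)
  Adj-∷⁻ (inj₁ (there xy∈)) = inj₁ (inj₁ xy∈)
  Adj-∷⁻ (inj₂ (here refl))  = inj₂ (inj₂ refl)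
  Adj-∷⁻ (inj₂ (there yx∈)) = inj₁ (inj₂ yx∈)

  IsTriangle-∷⁻ : ∀ {G : Graph {n}} {p q T} → IsTriangle ((p , q) ∷ G) T → IsTriangle G T ⊎ p ∈ corners T
  IsTriangle-∷⁻ (xy , yz , xz) with Adj-∷⁻ xy | Adj-∷⁻ yz | Adj-∷⁻ xz
  ... | inj₂ (inj₁ refl) | _                | _                = inj₂ (here refl)
  ... | inj₂ (inj₂ refl) | _                | _                = inj₂ (there (here refl))
  ... | inj₁ _           | inj₂ (inj₁ refl) | _                = inj₂ (there (here refl))
  ... | inj₁ _           | inj₂ (inj₂ refl) | _                = inj₂ (there (there (here refl)))
  ... | inj₁ _           | inj₁ _           | inj₂ (inj₁ refl) = inj₂ (here refl)
  ... | inj₁ _           | inj₁ _           | inj₂ (inj₂ refl) = inj₂ (there (there (here refl)))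
  ... | inj₁ xy′         | inj₁ yz′         | inj₁ xz′         = inj₁ (xy′ , yz′ , xz′)

  Conn-∷-within⁻ : ∀ {C : Graph {n}} {c a b v} → Conn C c a → Conn C c b → Conn ((a , b) ∷ C) a v → Conn C c v
  Conn-∷-within⁻ {C} {c} {a} {b} c~a c~b = walk c~a
    where
    walk : ∀ {s v} → Conn C c s → Conn ((a , b) ∷ C) s v → Conn C c v
    walk c~s ε                         = c~s
    walk c~s (inj₁ (here refl)  ◅ s~v) = walk c~b s~v
    walk c~s (inj₁ (there st∈) ◅ s~v) = walk (Conn-snoc c~s (inj₁ st∈)) s~v
    walk c~s (inj₂ (here refl)  ◅ s~v) = walk c~a s~v
    walk c~s (inj₂ (there ts∈) ◅ s~v) = walk (Conn-snoc c~s (inj₂ ts∈)) s~v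

  Conn-∷-within⁺ : ∀ {C : Graph {n}} {c a b v} → Conn C c a → Conn C c v → Conn ((a , b) ∷ C) a v
  Conn-∷-within⁺ c~a c~v = Conn-weaken (Conn-sym c~a) ◅◅ Conn-weaken c~v

  chord-inside-factorTriangle : ∀ {C : Graph {n}} {c a b} → Conn C c a → Conn C c b → ¬ Adj C a b →
    (D : DeclarableAt ((a , b) ∷ C) a) → triangleIndex (factorOf D) a ≡ triangleIndex (factorOf D) b
  chord-inside-factorTriangle {C} {c} {a} {b} c~a c~b ¬ab D =
    nonBridge-inside-factorTriangle D (here refl) ε λ col resp → walk resp ε (Conn-sym c~a ◅◅ c~b)
    where
    edge∈C : ∀ {s t} (st : Adj C s t) → edgeOf (Adj-weaken st) ≡ (a , b) → (a , b) ∈ C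
    edge∈C st st≡ab = subst (_∈ C) (trans (sym (edgeOf-weaken st)) st≡ab) (edgeOf-∈ st)
    walk : ∀ {col s t} → RespectsExcept col ((a , b) ∷ C) a (a , b) →
      Conn ((a , b) ∷ C) a s → Conn C s t → col s ≡ col t
    walk resp a~s ε          = refl
    walk resp a~s (st ◅ t~v) =
      trans (RespectsExcept-adj resp a~s (Adj-weaken st) (¬ab ∘ inj₁ ∘ edge∈C st))
            (walk resp (Conn-snoc a~s (Adj-weaken st)) t~v)

  triangleEdge-inside-factorTriangle : ∀ {H : Graph {n}} {r p q w} → Loopless H → (D : DeclarableAt H r) →
    Conn H r p → Adj H p q → Adj H q w → Adj H p w → triangleIndex (factorOf D) p ≡ triangleIndex (factorOf D) q
  triangleEdge-inside-factorTriangle {H} {r} {p} {q} {w} H! D r~p pq qw pw =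
    Monochromatic-same (edgeOf-same pq)
      (nonBridge-inside-factorTriangle D (edgeOf-∈ pq) (Conn-edgeOf r~p pq) λ col resp →
        Monochromatic-same⁻ (edgeOf-same pq)
          (trans (RespectsExcept-adj resp r~p pw (avoids pw (SameEdge-swap (edgeOf-same pw))))
                 (sym (RespectsExcept-adj resp (Conn-snoc r~p pq) qw (avoids qw (SameEdge-swap (edgeOf-same qw)))))))
    where
    w≢p : w ≢ p
    w≢p = Adj-irrefl H! pw ∘ sym
    w≢q : w ≢ q
    w≢q = Adj-irrefl H! qw ∘ sym
    avoids : ∀ {s t} (st : Adj H s t) {u} → SameEdge (edgeOf st) (w , u) → edgeOf st ≢ edgeOf pq
    avoids _ same = SameEdge-distinct same (edgeOf-same pq) w≢p w≢q

  triangle-is-factorTriangle : ∀ {H : Graph {n}} {r x y z} → Loopless H → (D : DeclarableAt H r) →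
    IsTriangle H (x , y , z) → Conn H r x →
    Σ (Triple {n}) λ T → T ∈ factorOf D × corners T ⊆ corners (x , y , z) × corners (x , y , z) ⊆ corners T
  triangle-is-factorTriangle {H} {r} {x} {y} {z} H! D@((ts , _ , ts! , _ , K⊆ts) , _) (xy , yz , xz) r~x
    with ∈-verts⁻ {ts = ts} (K⊆ts x r~x)
  ... | T , T∈ , x∈T = T , T∈ , Unique-⊆-length≥⇒⊇ Fin._≟_ xyz! xyz⊆T ≤-refl , xyz⊆T
    where
    x~y : triangleIndex ts x ≡ triangleIndex ts y
    x~y = triangleEdge-inside-factorTriangle H! D r~x xy yz xz
    y~z : triangleIndex ts y ≡ triangleIndex ts z
    y~z = triangleEdge-inside-factorTriangle H! D (Conn-snoc r~x xy) yz (Adj-sym xz) (Adj-sym xy)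
    xyz⊆T : corners (x , y , z) ⊆ corners T
    xyz⊆T (here refl)                 = x∈T
    xyz⊆T (there (here refl))         = sameIndex⇒corner ts ts! T∈ x∈T (sym x~y)
    xyz⊆T (there (there (here refl))) = sameIndex⇒corner ts ts! T∈ x∈T (sym (trans x~y y~z))
    xyz! : Unique (x ∷ y ∷ z ∷ [])
    xyz! = (Adj-irrefl H! xy ∷ Adj-irrefl H! xz ∷ []) ∷ (Adj-irrefl H! yz ∷ []) ∷ [] ∷ []

  crucialEdge-avoids-oldTriangles : ∀ {C : Graph {n}} {c a b x y z} → Loopless C → a ≢ b →
    Conn C c a → Conn C c b → ¬ Adj C a b → DeclarableAt ((a , b) ∷ C) a →
    IsTriangle C (x , y , z) → Conn C c x → ¬ (a ∈ corners (x , y , z) ⊎ b ∈ corners (x , y , z))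
  crucialEdge-avoids-oldTriangles {a = a} {b} C! a≢b c~a c~b ¬ab D@((ts , _ , ts! , _) , _) τ@(xy , yz , xz) c~x a∈∨b∈
    with triangle-is-factorTriangle (Loopless-∷ a≢b C!) D (Adj-weaken xy , Adj-weaken yz , Adj-weaken xz)
                                    (Conn-∷-within⁺ c~a c~x)
  ... | T , T∈ , T⊆τ , τ⊆T = ¬ab (triangle-adj τ (proj₁ both) (proj₂ both) a≢b)
    where
    a~b : triangleIndex ts a ≡ triangleIndex ts b
    a~b = chord-inside-factorTriangle c~a c~b ¬ab D
    both : a ∈ corners (_ , _ , _) × b ∈ corners (_ , _ , _)
    both = case a∈∨b∈ of λ where
      (inj₁ a∈) → a∈ , T⊆τ (sameIndex⇒corner ts ts! T∈ (τ⊆T a∈) (sym a~b))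
      (inj₂ b∈) → T⊆τ (sameIndex⇒corner ts ts! T∈ (τ⊆T b∈) a~b) , b∈

  factorTriangle-through-crucialEdge-is-new : ∀ {C : Graph {n}} {c a b a′ b′ T} → Loopless C → a ≢ b →
    Conn C c a → Conn C c b → ¬ Adj C a b → DeclarableAt ((a , b) ∷ C) a →
    Conn C c a′ → Conn C c b′ → (D′ : DeclarableAt ((a′ , b′) ∷ C) a′) →
    T ∈ factorOf D′ → a ∈ corners T ⊎ b ∈ corners T → a′ ∈ corners T
  factorTriangle-through-crucialEdge-is-new C! a≢b c~a c~b ¬ab D c~a′ c~b′ ((_ , τs′ , _ , ts′⊆K , _) , _)
    T∈ a∈∨b∈
    with IsTriangle-∷⁻ (All.lookup τs′ T∈)
  ... | inj₂ a′∈T = a′∈T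
  ... | inj₁ old  = ⊥-elim (crucialEdge-avoids-oldTriangles C! a≢b c~a c~b ¬ab D old
                      (Conn-∷-within⁻ c~a′ c~b′ (ts′⊆K _ (∈-verts⁺ T∈ (here refl)))) a∈∨b∈)

  Adj-∷-new : ∀ {G : Graph {n}} {a b a′ b′} → Adj ((a′ , b′) ∷ G) a b → ¬ Adj G a b → SameEdge (a , b) (a′ , b′)
  Adj-∷-new (inj₁ (here refl))  _   = inj₁ (refl , refl)
  Adj-∷-new (inj₂ (here refl))  _   = inj₂ (refl , refl)
  Adj-∷-new (inj₁ (there ab∈)) ¬ab = ⊥-elim (¬ab (inj₁ ab∈))
  Adj-∷-new (inj₂ (there ba∈)) ¬ab = ⊥-elim (¬ab (inj₂ ba∈))

lemma3p5 : (n : ℕ) → 3 ∣ n →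
    ∀ {C W : Graph {n}} {good : Fin n → Set} → Reachable C W good →
    (c : Fin n) → ¬ good c →
    ∀ (a b a' b' : Fin n) →
    Conn C c a → Conn C c b → Crucial C W good (a , b) →
    Conn C c a' → Conn C c b' → Crucial C W good (a' , b') →
    SameEdge (a , b) (a' , b')
lemma3p5 n _ R c _ a b a′ b′ c~a c~b ((a≢b , ¬ab , _) , _ , _ , D) c~a′ c~b′
  (_ , _ , _ , D′@((ts′ , τs′ , ts′! , _ , K⊆ts′) , _))
  with ∈-verts⁻ (K⊆ts′ a (Conn-∷-within⁺ c~a′ c~a)) | ∈-verts⁻ (K⊆ts′ b (Conn-∷-within⁺ c~a′ c~b))
... | Ta , Ta∈ , a∈Ta | Tb , Tb∈ , b∈Tb =
  Adj-∷-new (triangle-adj (All.lookup τs′ Ta∈) a∈Ta (Tb⊆Ta b∈Tb) a≢b) ¬ab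
  where
  through-a′ : ∀ {T} → T ∈ ts′ → a ∈ corners T ⊎ b ∈ corners T → a′ ∈ corners T
  through-a′ = factorTriangle-through-crucialEdge-is-new (Reachable⇒Loopless R) a≢b c~a c~b ¬ab D c~a′ c~b′ D′
  Tb⊆Ta : corners Tb ⊆ corners Ta
  Tb⊆Ta = sharedCorner⇒corners-⊆ ts′ ts′! Ta∈ Tb∈ (through-a′ Ta∈ (inj₁ a∈Ta)) (through-a′ Tb∈ (inj₂ b∈Tb))
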